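{- Let $G=(V,E,\iota)$ be a finite multi-graph, $k$ a positive integer, and let $\phi$ be a proper local partial colouring of $G$ with colours in $[k]=\{1,\dots,k\}$. Let $e,e'\in E$ with $e=xy$, $e'=xz$, such that $(e,e')$ is a $\phi$-safe $\phi$-chain, and let $\phi'$ be the shift of $\phi$ along $(e,e')$. Then $\phi'$ is a proper local partial colouring and $\Phi(\phi')\le\Phi(\phi)$. Moreover, $\Phi(\phi')=\Phi(\phi)$ if and only if $\phi(e')\le d(z)+\pi(z)$.
   Context: A multi-graph $G=(V,E,\iota)$ has a map $\iota:E\to\binom V2$ giving each edge its two distinct end-points; $e=xy$ means $\iota(e)=\{x,y\}$. $\pi(x,y)$ is the number of edges with end-points $x,y$; $d(x)=\sum_{y\ne x}\pi(x,y)$ is the degree; $\pi(x)=\max_{y\neq x}\pi(x,y)$. A partial colouring is a function $\phi$ from a subset $\mathrm{dom}(\phi)\subseteq E$ to the colours; edges outside $\mathrm{dom}(\phi)$ are uncoloured. It is proper if no two distinct coloured edges sharing a vertex get the same colour, and local if every coloured edge $e$ has an end-point $x$ with $\phi(e)\le d(x)+\pi(x)$. A $\phi$-chain $(e,e')$ consists of distinct edges with $e$ uncoloured, $e'$ coloured, sharing exactly one vertex; writing $e=xy$, $e'=xz$ (so $y\neq z$), it is $\phi$-safe if $\phi(e')\le d(y)+\pi(y)$ and no edge incident to $y$ has colour $\phi(e')$. The shift of $\phi$ along $(e,e')$ is the partial colouring $\phi'$ with domain $(\mathrm{dom}(\phi)\setminus\{e'\})\cup\{e\}$, agreeing with $\phi$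 except $\phi'(e)=\phi(e')$ and $e'$ uncoloured. For a partial colouring $\phi$ with colours in $[k]$: $A_\phi(x)=[k]\setminus\{\phi(f): f\ni x \text{ coloured}\}$ (missing colours), $\tilde A_\phi(x)=A_\phi(x)\cap[d(x)+\pi(x)]$ (safe colours), and the potential is $\Phi(\phi)=\sum_{x\in V}|\tilde A_\phi(x)|$. -}

module Defs where

open import Data.Nat using (ℕ; suc; _+_; _≤_; _⊔_)
open import Data.Fin using (Fin)
open import Data.Fin.Properties using (_≟_)
open import Data.List using (List; length; filter; map; foldr; upTo; allFin)
open import Data.Nat.ListAction using (sum)
open import Data.Maybe using (Maybe; just; nothing)
open import Data.Maybe.Properties using (≡-dec)
import Data.Nat.Properties as ℕP
open import Data.Product using (_×_; _,_; proj₁; proj₂; Σ; ∃; ∃-syntax)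
open import Data.Sum using (_⊎_)
open import Relation.Binary.PropositionalEquality using (_≡_; _≢_)
open import Relation.Nullary using (¬_; Dec; yes; no)
open import Relation.Nullary.Decidable using (_⊎-dec_; _×-dec_; ¬?)

-- A finite multi-graph: vertices Fin n, edges Fin m, each edge has two
-- distinct end-points (the unordered pair {proj₁, proj₂} of ends e).
record MultiGraph : Set where
  field
    n    : ℕ
    m    : ℕ
    ends : Fin m → Fin n × Fin n
    loopless : ∀ (e : Fin m) → proj₁ (ends e) ≢ proj₂ (ends e)

module _ (G : MultiGraph) where
  open MultiGraph G

  Vertex : Set
  Vertex = Fin n

  Edge : Set
  Edge = Fin m

  EdgeIs : Edge → Vertex → Vertex → Set
  EdgeIs e x y = (proj₁ (ends e) ≡ x × proj₂ (ends e) ≡ y)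
               ⊎ (proj₁ (ends e) ≡ y × proj₂ (ends e) ≡ x)

  edgeIs? : ∀ e x y → Dec (EdgeIs e x y)
  edgeIs? e x y = ((proj₁ (ends e) ≟ x) ×-dec (proj₂ (ends e) ≟ y))
             ⊎-dec ((proj₁ (ends e) ≟ y) ×-dec (proj₂ (ends e) ≟ x))

  Incident : Vertex → Edge → Set
  Incident x e = proj₁ (ends e) ≡ x ⊎ proj₂ (ends e) ≡ x

  incident? : ∀ x e → Dec (Incident x e)
  incident? x e = (proj₁ (ends e) ≟ x) ⊎-dec (proj₂ (ends e) ≟ x)

  mult : Vertex → Vertex → ℕ
  mult x y = length (filter (λ e → edgeIs? e x y) (allFin m))

  others : Vertex → List Vertex
  others x = filter (λ y → ¬? (y ≟ x)) (allFin n)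

  deg : Vertex → ℕ
  deg x = sum (map (mult x) (others x))

  -- π(x) = max_{y ≠ x} π(x,y)   (0 if there is no other vertex)
  maxMult : Vertex → ℕ
  maxMult x = foldr _⊔_ 0 (map (mult x) (others x))

  -- partial colourings: uncoloured edges are sent to nothing
  PartialColouring : Set
  PartialColouring = Edge → Maybe ℕ

  ColoursIn : ℕ → PartialColouring → Set
  ColoursIn k φ = ∀ e c → φ e ≡ just c → 1 ≤ c × c ≤ k

  Proper : PartialColouring → Set
  Proper φ = ∀ e f c → e ≢ f → (∃[ x ] (Incident x e × Incident x f))
           → φ e ≡ just c → φ f ≡ just c → Data.Empty.⊥
    where import Data.Empty

  Local : PartialColouring → Set
  Local φ = ∀ e c → φ e ≡ just c → ∃[ x ] (Incident x e × c ≤ deg x + maxMult x)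

  Chain : PartialColouring → Edge → Edge → Vertex → Vertex → Vertex → ℕ → Set
  Chain φ e e' x y z c =
    e ≢ e' × φ e ≡ nothing × φ e' ≡ just c
    × EdgeIs e x y × EdgeIs e' x z × y ≢ z

  -- the chain (e = xy , e') with φ(e') = c is φ-safe
  Safe : PartialColouring → Vertex → ℕ → Set
  Safe φ y c = c ≤ deg y + maxMult y
             × (∀ f → Incident y f → φ f ≢ just c)

  shift : PartialColouring → Edge → Edge → PartialColouring
  shift φ e e' f with f ≟ e
  ... | yes _ = φ e'
  ... | no _ with f ≟ e'
  ...   | yes _ = nothing
  ...   | no _  = φ f

  Used : PartialColouring → Vertex → ℕ → Set
  Used φ x c = ∃[ f ] (Incident x f × φ f ≡ just c)

  used? : ∀ φ x c → Dec (Used φ x c)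
  used? φ x c = Data.Fin.Properties.any? (λ f → incident? x f ×-dec ≡-dec ℕP._≟_ (φ f) (just c))
    where import Data.Fin.Properties

  colours : ℕ → List ℕ
  colours k = map suc (upTo k)

  safeMissing : ℕ → PartialColouring → Vertex → ℕ
  safeMissing k φ x =
    length (filter (λ c → ¬? (used? φ x c) ×-dec (c ℕP.≤? deg x + maxMult x)) (colours k))

  potential : ℕ → PartialColouring → ℕ
  potential k φ = sum (map (safeMissing k φ) (allFin n))

  ProperLocal : ℕ → PartialColouring → Set
  ProperLocal k φ = ColoursIn k φ × Proper φ × Local φ

-- Shifting c from e' = xz to e = xy changes the colours present only at y and z. At y the colour c
-- was missing and safe (the chain is φ-safe) and becomes used, so |Ã(y)| drops by one; at z the
-- colour c becomes missing (φ is proper, so e' was its only edge coloured c), so |Ã(z)| grows by one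
-- exactly when c ≤ d(z) + π(z). Hence Φ(φ') = Φ(φ) − 1 + [c ≤ d(z) + π(z)]. The recoloured edge e
-- clashes with nothing, since c is absent at y by safety and at x away from e' by properness, and
-- it is local through its end-point y.
module Submission where

open import Data.Fin.Properties using (_≟_)
open import Data.List using ([]; _∷_; length; filter; map)
open import Data.List.Membership.Propositional using (_∈_)
open import Data.List.Membership.Propositional.Properties using (∈-map⁺; ∈-upTo⁺; ∈-allFin)
open import Data.List.Properties using (filter-accept; filter-reject; filter-≐; map-cong-local)
open import Data.List.Relation.Unary.All as All using (All)
open import Data.List.Relation.Unary.Any using (here; there)
open import Data.List.Relation.Unary.Unique.Propositional using (Unique; _∷_)
open import Data.List.Relation.Unary.Unique.Propositional.Properties using (map⁺; upTo⁺; allFin⁺)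
open import Data.Maybe using (just; nothing)
open import Data.Maybe.Properties using (just-injective)
open import Data.Nat using (ℕ; suc; _+_; _≤_; _<_; NonZero)
open import Data.Nat.ListAction using (sum)
import Data.Nat.Properties as ℕP
open import Algebra.Properties.CommutativeSemigroup ℕP.+-commutativeSemigroup
  using (xy∙z≈xz∙y; xy∙z≈zy∙x)
open import Data.Product using (_×_; _,_; proj₁; proj₂; ∃-syntax)
open import Data.Sum using (_⊎_; inj₁; inj₂)
open import Function using (_∘_; const; flip)
open import Function.Bundles using (_⇔_; mk⇔; Equivalence)
open import Function.Construct.Symmetry using (⇔-sym)
open import Level using (0ℓ)
open import Relation.Binary.Definitions using (DecidableEquality)
open import Relation.Binary.PropositionalEquality
open import Relation.Nullary using (¬_; yes; no; contradiction)
open import Relation.Unary using (Pred; Decidable)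

open import Defs

open Equivalence using (to; from)

module _ {A : Set} {P Q : Pred A 0ℓ} (P? : Decidable P) (Q? : Decidable Q) where

  filter-≐-local : ∀ {xs} → All (λ v → P v ⇔ Q v) xs → filter P? xs ≡ filter Q? xs
  filter-≐-local All.[] = refl
  filter-≐-local {v ∷ xs} (P⇔Q All.∷ rest) with P? v
  ... | yes Pv = trans (cong (v ∷_) (filter-≐-local rest)) (sym (filter-accept Q? (to P⇔Q Pv)))
  ... | no ¬Pv = trans (filter-≐-local rest) (sym (filter-reject Q? (¬Pv ∘ from P⇔Q)))

  length-filter-≐ : (∀ v → P v ⇔ Q v) → ∀ xs → length (filter P? xs) ≡ length (filter Q? xs)
  length-filter-≐ P⇔Q xs =
    cong length (filter-≐ P? Q? ((λ {v} → to (P⇔Q v)) , (λ {v} → from (P⇔Q v))) xs)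

  length-filter-∷ : ∀ {v xs} → P v ⇔ Q v →
    length (filter P? xs) ≡ suc (length (filter Q? xs)) →
    length (filter P? (v ∷ xs)) ≡ suc (length (filter Q? (v ∷ xs)))
  length-filter-∷ {v} P⇔Q eq with P? v
  ... | yes Pv = trans (cong suc eq) (cong (suc ∘ length) (sym (filter-accept Q? (to P⇔Q Pv))))
  ... | no ¬Pv = trans eq (cong (suc ∘ length) (sym (filter-reject Q? (¬Pv ∘ from P⇔Q))))

  length-filter-≐-except : ∀ {a xs} → Unique xs → a ∈ xs → P a → ¬ Q a →
    (∀ v → v ≢ a → P v ⇔ Q v) → length (filter P? xs) ≡ suc (length (filter Q? xs))
  length-filter-≐-except {a} {a ∷ xs} (a∉xs ∷ _) (here refl) Pa ¬Qa P⇔Q = begin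
    length (filter P? (a ∷ xs))  ≡⟨ cong length (filter-accept P? Pa) ⟩
    suc (length (filter P? xs))  ≡⟨ cong (suc ∘ length) (filter-≐-local (All.map (P⇔Q _ ∘ ≢-sym) a∉xs)) ⟩
    suc (length (filter Q? xs))  ≡⟨ cong (suc ∘ length) (filter-reject Q? ¬Qa) ⟨
    suc (length (filter Q? (a ∷ xs))) ∎
    where open ≡-Reasoning
  length-filter-≐-except {a} {v ∷ xs} (v∉xs ∷ u) (there a∈xs) Pa ¬Qa P⇔Q =
    length-filter-∷ (P⇔Q v (All.lookup v∉xs a∈xs)) (length-filter-≐-except u a∈xs Pa ¬Qa P⇔Q)

module _ {A : Set} where
  open ≡-Reasoning

  sum-map-≡-except : ∀ {a xs} (f g : A → ℕ) → Unique xs → a ∈ xs →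
    (∀ v → v ≢ a → f v ≡ g v) → sum (map f xs) + g a ≡ sum (map g xs) + f a
  sum-map-≡-except {a} {a ∷ xs} f g (a∉xs ∷ _) (here refl) f≡g = begin
    f a + sum (map f xs) + g a  ≡⟨ cong (λ s → f a + sum s + g a) f≡g-on-xs ⟩
    f a + sum (map g xs) + g a  ≡⟨ xy∙z≈zy∙x (f a) _ (g a) ⟩
    g a + sum (map g xs) + f a  ∎
    where f≡g-on-xs = map-cong-local (All.map (f≡g _ ∘ ≢-sym) a∉xs)
  sum-map-≡-except {a} {v ∷ xs} f g (v∉xs ∷ u) (there a∈xs) f≡g = begin
    f v + sum (map f xs) + g a    ≡⟨ ℕP.+-assoc (f v) _ _ ⟩
    f v + (sum (map f xs) + g a)  ≡⟨ cong₂ _+_ (f≡g v (All.lookup v∉xs a∈xs))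
                                                 (sum-map-≡-except f g u a∈xs f≡g) ⟩
    g v + (sum (map g xs) + f a)  ≡⟨ ℕP.+-assoc (g v) _ _ ⟨
    g v + sum (map g xs) + f a    ∎

  -- Two one-point exchanges, through the function h that agrees with g at a and with f elsewhere.
  sum-map-≡-except₂ : DecidableEquality A → ∀ {a b xs} (f g : A → ℕ) →
    Unique xs → a ∈ xs → b ∈ xs → a ≢ b → (∀ v → v ≢ a → v ≢ b → f v ≡ g v) →
    sum (map f xs) + g a + g b ≡ sum (map g xs) + f a + f b
  sum-map-≡-except₂ _≟ᴬ_ {a} {b} {xs} f g u a∈xs b∈xs a≢b f≡g = begin
    sum (map f xs) + g a + g b  ≡⟨ cong (λ t → sum (map f xs) + t + g b) (h≡g a a≢b) ⟨
    sum (map f xs) + h a + g b  ≡⟨ cong (_+ g b) (sum-map-≡-except f h u a∈xs f≡h) ⟩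
    sum (map h xs) + f a + g b  ≡⟨ xy∙z≈xz∙y (sum (map h xs)) (f a) (g b) ⟩
    sum (map h xs) + g b + f a  ≡⟨ cong (_+ f a) (sum-map-≡-except h g u b∈xs h≡g) ⟩
    sum (map g xs) + h b + f a  ≡⟨ cong (λ t → sum (map g xs) + t + f a) (f≡h b (a≢b ∘ sym)) ⟨
    sum (map g xs) + f b + f a  ≡⟨ xy∙z≈xz∙y (sum (map g xs)) (f b) (f a) ⟩
    sum (map g xs) + f a + f b  ∎
    where
    h : A → ℕ
    h v with v ≟ᴬ a
    ... | yes _ = g v
    ... | no _ = f v

    f≡h : ∀ v → v ≢ a → f v ≡ h v
    f≡h v v≢a with v ≟ᴬ a
    ... | yes v≡a = contradiction v≡a v≢a
    ... | no _ = refl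

    h≡g : ∀ v → v ≢ b → h v ≡ g v
    h≡g v v≢b with v ≟ᴬ a
    ... | yes _ = refl
    ... | no v≢a = f≡g v v≢a v≢b

module _ (G : MultiGraph) where
  open MultiGraph G using (loopless)

  EdgeIs⇒Incidentˡ : ∀ {f a b} → EdgeIs G f a b → Incident G a f
  EdgeIs⇒Incidentˡ (inj₁ (p , _)) = inj₁ p
  EdgeIs⇒Incidentˡ (inj₂ (_ , q)) = inj₂ q

  EdgeIs⇒Incidentʳ : ∀ {f a b} → EdgeIs G f a b → Incident G b f
  EdgeIs⇒Incidentʳ (inj₁ (_ , q)) = inj₂ q
  EdgeIs⇒Incidentʳ (inj₂ (p , _)) = inj₁ p

  EdgeIs-Incident⇒≡⊎≡ : ∀ {f a b v} → EdgeIs G f a b → Incident G v f → v ≡ a ⊎ v ≡ b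
  EdgeIs-Incident⇒≡⊎≡ (inj₁ (p , _)) (inj₁ r) = inj₁ (trans (sym r) p)
  EdgeIs-Incident⇒≡⊎≡ (inj₁ (_ , q)) (inj₂ r) = inj₂ (trans (sym r) q)
  EdgeIs-Incident⇒≡⊎≡ (inj₂ (p , _)) (inj₁ r) = inj₂ (trans (sym r) p)
  EdgeIs-Incident⇒≡⊎≡ (inj₂ (_ , q)) (inj₂ r) = inj₁ (trans (sym r) q)

  EdgeIs⇒≢ : ∀ {f a b} → EdgeIs G f a b → a ≢ b
  EdgeIs⇒≢ {f} (inj₁ (p , q)) a≡b = loopless f (trans p (trans a≡b (sym q)))
  EdgeIs⇒≢ {f} (inj₂ (p , q)) a≡b = loopless f (trans p (trans (sym a≡b) (sym q)))

  colours-unique : ∀ k → Unique (colours G k)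
  colours-unique k = map⁺ ℕP.suc-injective (upTo⁺ k)

  ∈-colours : ∀ {k c} → 1 ≤ c × c ≤ k → c ∈ colours G k
  ∈-colours {c = suc c} (_ , c<k) = ∈-map⁺ suc (∈-upTo⁺ c<k)

  SafeMissing : PartialColouring G → Vertex G → ℕ → Set
  SafeMissing ψ v c = ¬ Used G ψ v c × c ≤ deg G v + maxMult G v

  SafeMissing-⇔ : ∀ {ψ ψ' v c} → Used G ψ v c ⇔ Used G ψ' v c → SafeMissing ψ' v c ⇔ SafeMissing ψ v c
  SafeMissing-⇔ used⇔ = mk⇔ (λ (¬u , c≤) → ¬u ∘ to used⇔ , c≤) (λ (¬u , c≤) → ¬u ∘ from used⇔ , c≤)

module _ (G : MultiGraph) (φ : PartialColouring G) {e e' : Edge G} (e≢e' : e ≢ e') where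

  shift-source : shift G φ e e' e ≡ φ e'
  shift-source with e ≟ e
  ... | yes _ = refl
  ... | no e≢e = contradiction refl e≢e

  shift-target : shift G φ e e' e' ≡ nothing
  shift-target with e' ≟ e
  ... | yes e'≡e = contradiction (sym e'≡e) e≢e'
  ... | no _ with e' ≟ e'
  ...   | yes _ = refl
  ...   | no e'≢e' = contradiction refl e'≢e'

  shift-other : ∀ {f} → f ≢ e → f ≢ e' → shift G φ e e' f ≡ φ f
  shift-other {f} f≢e f≢e' with f ≟ e
  ... | yes f≡e = contradiction f≡e f≢e
  ... | no _ with f ≟ e'
  ...   | yes f≡e' = contradiction f≡e' f≢e'
  ...   | no _ = refl

  data ShiftView (f : Edge G) : Set where
    source : f ≡ e → shift G φ e e' f ≡ φ e' → ShiftView f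
    target : f ≡ e' → shift G φ e e' f ≡ nothing → ShiftView f
    other  : f ≢ e → f ≢ e' → shift G φ e e' f ≡ φ f → ShiftView f

  shiftView : ∀ f → ShiftView f
  shiftView f with f ≟ e | f ≟ e'
  ... | yes refl | _ = source refl shift-source
  ... | no _ | yes refl = target refl shift-target
  ... | no f≢e | no f≢e' = other f≢e f≢e' (shift-other f≢e f≢e')

module ShiftAlongSafeChain
  (G : MultiGraph) (k : ℕ) (φ : PartialColouring G) (colouredIn : ColoursIn G k φ) (proper : Proper G φ)
  {e e' : Edge G} {x y z : Vertex G} {c : ℕ}
  (e≢e' : e ≢ e') (φe≡nothing : φ e ≡ nothing) (φe'≡c : φ e' ≡ just c)
  (e=xy : EdgeIs G e x y) (e'=xz : EdgeIs G e' x z) (y≢z : y ≢ z) (safe : Safe G φ y c)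
  where

  φ' : PartialColouring G
  φ' = shift G φ e e'

  colour-e' : ∀ {c'} → φ e' ≡ just c' → c' ≡ c
  colour-e' φe'≡c' = just-injective (trans (sym φe'≡c') φe'≡c)

  c-unused-around-e : ∀ f → f ≢ e' → (∃[ v ] (Incident G v e × Incident G v f)) → φ f ≢ just c
  c-unused-around-e f f≢e' (v , v∈e , v∈f) with EdgeIs-Incident⇒≡⊎≡ G e=xy v∈e
  ... | inj₁ refl = λ φf≡c → proper f e' c f≢e' (v , v∈f , EdgeIs⇒Incidentˡ G e'=xz) φf≡c φe'≡c
  ... | inj₂ refl = proj₂ safe f v∈f

  shift-coloursIn : ColoursIn G k φ'
  shift-coloursIn f c' φ'f≡c' with shiftView G φ e≢e' f
  ... | source refl eq = colouredIn e' c' (trans (sym eq) φ'f≡c')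
  ... | target refl eq with () ← trans (sym eq) φ'f≡c'
  ... | other _ _ eq = colouredIn f c' (trans (sym eq) φ'f≡c')

  shift-local : Local G φ → Local G φ'
  shift-local local f c' φ'f≡c' with shiftView G φ e≢e' f
  ... | source refl eq rewrite colour-e' (trans (sym eq) φ'f≡c') = y , EdgeIs⇒Incidentʳ G e=xy , proj₁ safe
  ... | target refl eq with () ← trans (sym eq) φ'f≡c'
  ... | other _ _ eq = local f c' (trans (sym eq) φ'f≡c')

  shift-proper : Proper G φ'
  shift-proper f₁ f₂ c' f₁≢f₂ (v , v∈f₁ , v∈f₂) φ'f₁≡c' φ'f₂≡c'
    with shiftView G φ e≢e' f₁ | shiftView G φ e≢e' f₂
  ... | source refl _ | source refl _ = f₁≢f₂ refl
  ... | target refl eq | _ with () ← trans (sym eq) φ'f₁≡c'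
  ... | _ | target refl eq with () ← trans (sym eq) φ'f₂≡c'
  ... | source refl eq₁ | other _ f₂≢e' eq₂ rewrite colour-e' (trans (sym eq₁) φ'f₁≡c') =
    c-unused-around-e f₂ f₂≢e' (v , v∈f₁ , v∈f₂) (trans (sym eq₂) φ'f₂≡c')
  ... | other _ f₁≢e' eq₁ | source refl eq₂ rewrite colour-e' (trans (sym eq₂) φ'f₂≡c') =
    c-unused-around-e f₁ f₁≢e' (v , v∈f₂ , v∈f₁) (trans (sym eq₁) φ'f₁≡c')
  ... | other _ _ eq₁ | other _ _ eq₂ =
    proper f₁ f₂ c' f₁≢f₂ (v , v∈f₁ , v∈f₂) (trans (sym eq₁) φ'f₁≡c') (trans (sym eq₂) φ'f₂≡c')

  used-shift⇒used : ∀ {v c'} → y ≢ v → Used G φ' v c' → Used G φ v c'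
  used-shift⇒used y≢v (f , v∈f , φ'f≡c') with shiftView G φ e≢e' f
  ... | source refl eq with EdgeIs-Incident⇒≡⊎≡ G e=xy v∈f
  ...   | inj₁ refl = e' , EdgeIs⇒Incidentˡ G e'=xz , trans (sym eq) φ'f≡c'
  ...   | inj₂ refl = contradiction refl y≢v
  used-shift⇒used y≢v (f , v∈f , φ'f≡c') | target refl eq with () ← trans (sym eq) φ'f≡c'
  used-shift⇒used y≢v (f , v∈f , φ'f≡c') | other _ _ eq = f , v∈f , trans (sym eq) φ'f≡c'

  used⇒used-shift : ∀ {v c'} → z ≢ v → Used G φ v c' → Used G φ' v c'
  used⇒used-shift z≢v (f , v∈f , φf≡c') with shiftView G φ e≢e' f
  ... | source refl _ with () ← trans (sym φe≡nothing) φf≡c'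
  ... | target refl _ with EdgeIs-Incident⇒≡⊎≡ G e'=xz v∈f
  ...   | inj₁ refl = e , EdgeIs⇒Incidentˡ G e=xy , trans (shift-source G φ e≢e') φf≡c'
  ...   | inj₂ refl = contradiction refl z≢v
  used⇒used-shift z≢v (f , v∈f , φf≡c') | other _ _ eq = f , v∈f , trans eq φf≡c'

  used-shift⇔used-away : ∀ {v c'} → y ≢ v → z ≢ v → Used G φ' v c' ⇔ Used G φ v c'
  used-shift⇔used-away y≢v z≢v = mk⇔ (used-shift⇒used y≢v) (used⇒used-shift z≢v)

  used-shift⇔used-≢c : ∀ {v c'} → c' ≢ c → Used G φ' v c' ⇔ Used G φ v c'
  used-shift⇔used-≢c {v} {c'} c'≢c = mk⇔ forward backward
    where
    forward : Used G φ' v c' → Used G φ v c'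
    forward (f , v∈f , φ'f≡c') with shiftView G φ e≢e' f
    ... | source refl eq = contradiction (colour-e' (trans (sym eq) φ'f≡c')) c'≢c
    ... | target refl eq with () ← trans (sym eq) φ'f≡c'
    ... | other _ _ eq = f , v∈f , trans (sym eq) φ'f≡c'

    backward : Used G φ v c' → Used G φ' v c'
    backward (f , v∈f , φf≡c') with shiftView G φ e≢e' f
    ... | source refl _ with () ← trans (sym φe≡nothing) φf≡c'
    ... | target refl _ = contradiction (colour-e' φf≡c') c'≢c
    ... | other _ _ eq = f , v∈f , trans eq φf≡c'

  used-shift-y : Used G φ' y c
  used-shift-y = e , EdgeIs⇒Incidentʳ G e=xy , trans (shift-source G φ e≢e') φe'≡c

  ¬used-y : ¬ Used G φ y c
  ¬used-y (f , y∈f , φf≡c) = proj₂ safe f y∈f φf≡c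

  used-z : Used G φ z c
  used-z = e' , EdgeIs⇒Incidentʳ G e'=xz , φe'≡c

  ¬used-shift-z : ¬ Used G φ' z c
  ¬used-shift-z (f , z∈f , φ'f≡c) with shiftView G φ e≢e' f
  ... | source refl _ with EdgeIs-Incident⇒≡⊎≡ G e=xy z∈f
  ...   | inj₁ z≡x = EdgeIs⇒≢ G e'=xz (sym z≡x)
  ...   | inj₂ z≡y = y≢z (sym z≡y)
  ¬used-shift-z (f , z∈f , φ'f≡c) | target refl eq with () ← trans (sym eq) φ'f≡c
  ¬used-shift-z (f , z∈f , φ'f≡c) | other _ f≢e' eq =
    proper f e' c f≢e' (z , z∈f , EdgeIs⇒Incidentʳ G e'=xz) (trans (sym eq) φ'f≡c) φe'≡c

  safeMissing-away : ∀ {v} → y ≢ v → z ≢ v → safeMissing G k φ' v ≡ safeMissing G k φ v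
  safeMissing-away y≢v z≢v = length-filter-≐ _ _
    (λ _ → SafeMissing-⇔ G (⇔-sym (used-shift⇔used-away y≢v z≢v))) (colours G k)

  c∈colours : c ∈ colours G k
  c∈colours = ∈-colours G (colouredIn e' c φe'≡c)

  safeMissing-y : safeMissing G k φ y ≡ suc (safeMissing G k φ' y)
  safeMissing-y = length-filter-≐-except _ _ (colours-unique G k) c∈colours
    (¬used-y , proj₁ safe) (λ (¬used , _) → ¬used used-shift-y)
    (λ _ c'≢c → SafeMissing-⇔ G (used-shift⇔used-≢c c'≢c))

  safeMissing-z-≤ : c ≤ deg G z + maxMult G z → safeMissing G k φ' z ≡ suc (safeMissing G k φ z)
  safeMissing-z-≤ c≤ = length-filter-≐-except _ _ (colours-unique G k) c∈colours
    (¬used-shift-z , c≤) (λ (¬used , _) → ¬used used-z)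
    (λ _ c'≢c → SafeMissing-⇔ G (⇔-sym (used-shift⇔used-≢c c'≢c)))

  safeMissing-z-≰ : ¬ c ≤ deg G z + maxMult G z → safeMissing G k φ' z ≡ safeMissing G k φ z
  safeMissing-z-≰ c≰ = length-filter-≐ _ _ missing⇔ (colours G k)
    where
    missing⇔ : ∀ c' → SafeMissing G φ' z c' ⇔ SafeMissing G φ z c'
    missing⇔ c' with c' ℕP.≟ c
    ... | yes refl = mk⇔ (λ (_ , c≤) → contradiction c≤ c≰) (λ (¬used , _) → contradiction used-z ¬used)
    ... | no c'≢c = SafeMissing-⇔ G (⇔-sym (used-shift⇔used-≢c c'≢c))

  -- Φ(φ') − Φ(φ) = |Ã_φ'(z)| − |Ã_φ(z)| − 1, with the terms moved so that no subtraction occurs.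
  potential-balance : potential G k φ' + suc (safeMissing G k φ z) ≡ potential G k φ + safeMissing G k φ' z
  potential-balance = ℕP.+-cancelʳ-≡ (s' y) _ _ (begin
    Φ' + suc (s z) + s' y    ≡⟨ xy∙z≈xz∙y Φ' (suc (s z)) (s' y) ⟩
    Φ' + s' y + suc (s z)    ≡⟨ ℕP.+-suc (Φ' + s' y) (s z) ⟩
    suc (Φ' + s' y) + s z    ≡⟨ cong (_+ s z) (ℕP.+-suc Φ' (s' y)) ⟨
    Φ' + suc (s' y) + s z    ≡⟨ cong (λ t → Φ' + t + s z) safeMissing-y ⟨
    Φ' + s y + s z           ≡⟨ sum-map-≡-except₂ _≟_ s' s (allFin⁺ _) (∈-allFin y) (∈-allFin z) y≢z
                                  (λ _ v≢y v≢z → safeMissing-away (≢-sym v≢y) (≢-sym v≢z)) ⟩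
    Φ + s' y + s' z          ≡⟨ xy∙z≈xz∙y Φ (s' y) (s' z) ⟩
    Φ + s' z + s' y          ∎)
    where
    open ≡-Reasoning
    s s' : Vertex G → ℕ
    s = safeMissing G k φ
    s' = safeMissing G k φ'
    Φ Φ' : ℕ
    Φ = potential G k φ
    Φ' = potential G k φ'

  potential-shift-≡ : c ≤ deg G z + maxMult G z → potential G k φ' ≡ potential G k φ
  potential-shift-≡ c≤ = ℕP.+-cancelʳ-≡ _ _ _
    (trans potential-balance (cong (potential G k φ +_) (safeMissing-z-≤ c≤)))

  potential-shift-< : ¬ c ≤ deg G z + maxMult G z → potential G k φ' < potential G k φ
  potential-shift-< c≰ = ℕP.≤-reflexive (ℕP.+-cancelʳ-≡ _ _ _ (begin
    suc (potential G k φ') + safeMissing G k φ z  ≡⟨ ℕP.+-suc (potential G k φ') _ ⟨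
    potential G k φ' + suc (safeMissing G k φ z)  ≡⟨ potential-balance ⟩
    potential G k φ + safeMissing G k φ' z        ≡⟨ cong (potential G k φ +_) (safeMissing-z-≰ c≰) ⟩
    potential G k φ + safeMissing G k φ z         ∎))
    where open ≡-Reasoning

  shift-properLocal : Local G φ → ProperLocal G k φ'
  shift-properLocal local = shift-coloursIn , shift-proper , shift-local local

  potential-shift : potential G k φ' ≤ potential G k φ
    × (potential G k φ' ≡ potential G k φ ⇔ c ≤ deg G z + maxMult G z)
  potential-shift with c ℕP.≤? deg G z + maxMult G z
  ... | yes c≤ = ℕP.≤-reflexive (potential-shift-≡ c≤) , mk⇔ (const c≤) (const (potential-shift-≡ c≤))
  ... | no c≰ = ℕP.<⇒≤ (potential-shift-< c≰)
              , mk⇔ (flip contradiction (ℕP.<⇒≢ (potential-shift-< c≰))) (flip contradiction c≰)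

lemma2p1 : (G : MultiGraph) (k : ℕ) → NonZero k →
    (φ : PartialColouring G) → ProperLocal G k φ →
    (e e' : Edge G) (x y z : Vertex G) (c : ℕ) →
    Chain G φ e e' x y z c → Safe G φ y c →
    ProperLocal G k (shift G φ e e')
    × potential G k (shift G φ e e') ≤ potential G k φ
    × (potential G k (shift G φ e e') ≡ potential G k φ ⇔ c ≤ deg G z + maxMult G z)
lemma2p1 G k _ φ (colouredIn , proper , local) e e' x y z c
         (e≢e' , φe≡nothing , φe'≡c , e=xy , e'=xz , y≢z) safe =
  shift-properLocal local , potential-shift
  where open ShiftAlongSafeChain G k φ colouredIn proper e≢e' φe≡nothing φe'≡c e=xy e'=xz y≢z safe
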